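{- Let $G(n,k)\in\mathcal{C}$ and $(r)\in\{(p_{\Diamond}),(s_{\exists}^{1}),(s_{\exists}^{2})\}$. Then $(g_{n,k})$ can be permuted above $(r)$: any $(r)$ inference followed by a $(g_{n,k})$ inference can be transformed into a $(g_{n,k})$ inference followed by an $(r)$ inference.
   Context: $\mathcal{C}$ is a set of frame conditions for first-order modal logic drawn from: seriality $S$; general path conditions $G(n,k)$ (if $wR^{n}u$ and $wR^{k}v$ then $uRv$); increasing domains $I_{d}$; decreasing domains $D_{d}$; constant domains $C_{d}$ (treated as both $I_d$ and $D_d$); non-empty domains $N_{d}$. Let $\mathcal{G}$ be the set of $G(n,k)\in\mathcal{C}$. Strings over the alphabet $\{\Diamond,\Diamond^{ -1}\}$ ($\Diamond$: forward move, $\Diamond^{ -1}$: backward move, the "black diamond"). A semi-Thue system is a set of productions $a\longrightarrow s$; $L_{\mathrm{S}}(a)$ is the set of strings derivable from $a$ under the reflexive–transitive closure of one-step rewriting $s'as''\longrightarrow s'rs''$. $\mathrm{S}(\mathcal{G})$ contains $\Diamond\longrightarrow(\Diamond^{ -1})^{n}\Diamond^{k}$ and $\Diamond^{ -1}\longrightarrow(\Diamond^{ -1})^{k}\Diamond^{n}$ for each $G(n,k)\in\mathcal{G}$; $\mathrm{S4}=\{\Diamond\longrightarrow\varepsilon,\Diamond^{ -1}\longrightarrow\varepsilon,\Diamond\longrightarrow\Diamond\Diamond,\Diamond^{ -1}\longrightarrow\Diamond^{ -1}\Diamond^{ -1}\}$; $\mathrm{S5}=\{\Diamond\longrightarrow\varepsilon,\Diamond^{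 -1}\longrightarrow\varepsilon,\Diamond\longrightarrow\Diamond^{ -1}\Diamond,\Diamond^{ -1}\longrightarrow\Diamond^{ -1}\Diamond\}$. Labeled sequents $\mathcal{R},\Gamma\vdash\Delta$ with $\mathcal{R}$ relational atoms $wRu$ and domain atoms $x\in D(w)$, and labeled formulae $w:\phi$. The propagation graph of $\mathcal{R}$: vertices are labels; edges $(w,\Diamond,u)$ and $(u,\Diamond^{ -1},w)$ for each $wRu\in\mathcal{R}$. A propagation path follows edges; its string is the sequence of edge characters ($\varepsilon$ for the empty path). $y$ is $(\mathrm{S},a)$-available for $w$ iff for some $u$, $y\in D(u)\in\mathcal{R}$ and some propagation path from $w$ to $u$ has string in $L_{\mathrm{S}}(a)$. Relational rule $(g_{n,k})$: from $\mathcal{R},wR^{n}u,wR^{k}v,uRv,\Gamma\vdash\Delta$ infer $\mathcal{R},wR^{n}u,wR^{k}v,\Gamma\vdash\Delta$ (where $wR^{n}u$ abbreviates a chain $wRw_1,\dots,w_{n-1}Ru$, and $wR^0u$ means $w=u$). Reachability rules: $(p_{\Diamond})$: from $\mathcal{R},\Gamma\vdash w:\Diamond\phi,u:\phi,\Delta$ infer $\mathcal{R},\Gamma\vdash w:\Diamond\phi,\Delta$, provided some propagation path from $w$ to $u$ has string in $L_{\mathrm{S}(\mathcal{G})}(\Diamond)$. $(s_{\exists}^{1})$: from $\mathcal{R},\Gamma\vdash w:\phi[y/x],w:\exists x\phi,\Delta$ infer $\mathcal{R},\Gamma\vdash w:\exists x\phi,\Delta$, provided: if $I_d,D_d\in\mathcal{C}$,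 $y$ is $(\mathrm{S5},\Diamond)$-available for $w$; if only $I_d$, $(\mathrm{S4}\cup\mathrm{S}(\mathcal{G}),\Diamond^{ -1})$-available; if only $D_d$, $(\mathrm{S4}\cup\mathrm{S}(\mathcal{G}),\Diamond)$-available; if neither, $y\in D(w)\in\mathcal{R}$. $(s_{\exists}^{2})$: from $\mathcal{R},y\in D(u),\Gamma\vdash w:\phi[y/x],w:\exists x\phi,\Delta$ infer $\mathcal{R},\Gamma\vdash w:\exists x\phi,\Delta$, provided $y$ is fresh and some propagation path from $w$ to $u$ has string in $L_{\mathrm{S5}}(\Diamond)$ (if $I_d,D_d\in\mathcal{C}$), $L_{\mathrm{S4}\cup\mathrm{S}(\mathcal{G})}(\Diamond^{ -1})$ (only $I_d$), $L_{\mathrm{S4}\cup\mathrm{S}(\mathcal{G})}(\Diamond)$ (only $D_d$), or $w=u$ (neither). -}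

module Defs where

open import Data.Nat using (ℕ; zero; suc; _≡ᵇ_)
open import Data.Bool using (Bool; true; false; if_then_else_; _∨_)
open import Data.List using (List; []; _∷_; _++_; map; replicate; concatMap)
open import Data.List.Membership.Propositional using (_∈_; _∉_)
open import Data.List.Relation.Binary.Permutation.Propositional using (_↭_)
open import Data.Product using (Σ; _×_; _,_; proj₂; ∃-syntax)
open import Data.Sum using (_⊎_)
open import Relation.Nullary using (¬_)
open import Relation.Binary.PropositionalEquality using (_≡_)
open import Relation.Binary.Construct.Closure.ReflexiveTransitive using (Star)

record Conds : Set where
  field
    ser : Bool
    Gs  : List (ℕ × ℕ)         -- the G(n,k) ∈ 𝒞, i.e. the set 𝒢
    Id  : Bool                 -- increasing domains
    Dd  : Bool                 -- decreasing domains
    Cd  : Bool                 -- constant domains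
    Nd  : Bool                 -- non-empty domains
open Conds public

-- C_d is treated as both I_d and D_d
hasI : Conds → Bool
hasI 𝒞 = Id 𝒞 ∨ Cd 𝒞

hasD : Conds → Bool
hasD 𝒞 = Dd 𝒞 ∨ Cd 𝒞

data Dir : Set where
  fwd : Dir   -- ◇
  bwd : Dir   -- ◇⁻¹ (black diamond)

Production : Set
Production = Dir × List Dir

System : Set
System = List Production

data Step (S : System) : List Dir → List Dir → Set where
  step : ∀ s' s'' a r → (a , r) ∈ S → Step S (s' ++ a ∷ s'') (s' ++ r ++ s'')

L : System → Dir → List Dir → Set
L S a s = Star (Step S) (a ∷ []) s

SG : List (ℕ × ℕ) → System
SG = concatMap (λ { (n , k) →
        (fwd , replicate n bwd ++ replicate k fwd)
      ∷ (bwd , replicate k bwd ++ replicate n fwd) ∷ [] })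

S4 : System
S4 = (fwd , []) ∷ (bwd , []) ∷ (fwd , fwd ∷ fwd ∷ []) ∷ (bwd , bwd ∷ bwd ∷ []) ∷ []

S5 : System
S5 = (fwd , []) ∷ (bwd , []) ∷ (fwd , bwd ∷ fwd ∷ []) ∷ (bwd , bwd ∷ fwd ∷ []) ∷ []

data Fm : Set where
  atom : ℕ → List ℕ → Fm
  ⊥'   : Fm
  ¬'   : Fm → Fm
  _∧'_ : Fm → Fm → Fm
  _∨'_ : Fm → Fm → Fm
  _⇒'_ : Fm → Fm → Fm
  □'   : Fm → Fm
  ◇'   : Fm → Fm
  ∀'   : ℕ → Fm → Fm
  ∃'   : ℕ → Fm → Fm

-- φ[y/x] : replace the free occurrences of x by y
sub : Fm → ℕ → ℕ → Fm
sub (atom p xs) y x = atom p (map (λ z → if z ≡ᵇ x then y else z) xs)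
sub ⊥' y x = ⊥'
sub (¬' φ) y x = ¬' (sub φ y x)
sub (φ ∧' ψ) y x = sub φ y x ∧' sub ψ y x
sub (φ ∨' ψ) y x = sub φ y x ∨' sub ψ y x
sub (φ ⇒' ψ) y x = sub φ y x ⇒' sub ψ y x
sub (□' φ) y x = □' (sub φ y x)
sub (◇' φ) y x = ◇' (sub φ y x)
sub (∀' z φ) y x = if z ≡ᵇ x then ∀' z φ else ∀' z (sub φ y x)
sub (∃' z φ) y x = if z ≡ᵇ x then ∃' z φ else ∃' z (sub φ y x)

Occ : ℕ → Fm → Set
Occ y (atom p xs) = y ∈ xs
Occ y ⊥' = ⊥ where open import Data.Empty using (⊥)
Occ y (¬' φ) = Occ y φ
Occ y (φ ∧' ψ) = Occ y φ ⊎ Occ y ψ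
Occ y (φ ∨' ψ) = Occ y φ ⊎ Occ y ψ
Occ y (φ ⇒' ψ) = Occ y φ ⊎ Occ y ψ
Occ y (□' φ) = Occ y φ
Occ y (◇' φ) = Occ y φ
Occ y (∀' z φ) = y ≡ z ⊎ Occ y φ
Occ y (∃' z φ) = y ≡ z ⊎ Occ y φ

LF : Set
LF = ℕ × Fm

-- Labeled sequents  𝓡, Γ ⊢ Δ   (components as multisets: lists up to ↭)

data RAtom : Set where
  rel : ℕ → ℕ → RAtom   -- w R u
  dom : ℕ → ℕ → RAtom   -- x ∈ D(w)

record Sequent : Set where
  constructor _∣_⊢_
  field
    Rs : List RAtom
    Γ  : List LF
    Δ  : List LF
open Sequent public

Fresh : ℕ → Sequent → Set
Fresh y Q = (∀ u → dom y u ∉ Rs Q)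
          × (∀ lf → lf ∈ Γ Q → ¬ Occ y (proj₂ lf))
          × (∀ lf → lf ∈ Δ Q → ¬ Occ y (proj₂ lf))

data Path (R : List RAtom) : ℕ → ℕ → List Dir → Set where
  nil  : ∀ {w} → Path R w w []
  fwdE : ∀ {w x u s} → rel w x ∈ R → Path R x u s → Path R w u (fwd ∷ s)
  bwdE : ∀ {w x u s} → rel x w ∈ R → Path R x u s → Path R w u (bwd ∷ s)

Reach : System → Dir → List RAtom → ℕ → ℕ → Set
Reach S a R w u = ∃[ s ] (Path R w u s × L S a s)

Avail : System → Dir → List RAtom → ℕ → ℕ → Set
Avail S a R y w = ∃[ u ] (dom y u ∈ R × Reach S a R w u)

Cond1 : Bool → Bool → List (ℕ × ℕ) → List RAtom → ℕ → ℕ → Set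
Cond1 true  true  G R y w = Avail S5 fwd R y w
Cond1 true  false G R y w = Avail (S4 ++ SG G) bwd R y w
Cond1 false true  G R y w = Avail (S4 ++ SG G) fwd R y w
Cond1 false false G R y w = dom y w ∈ R

Cond2 : Bool → Bool → List (ℕ × ℕ) → List RAtom → ℕ → ℕ → Set
Cond2 true  true  G R w u = Reach S5 fwd R w u
Cond2 true  false G R w u = Reach (S4 ++ SG G) bwd R w u
Cond2 false true  G R w u = Reach (S4 ++ SG G) fwd R w u
Cond2 false false G R w u = w ≡ u

-- Rule instances:  Inf P C  means  "premise P, conclusion C"

Chain : List RAtom → ℕ → ℕ → ℕ → Set
Chain R zero    w u = w ≡ u
Chain R (suc n) w u = ∃[ w₁ ] (rel w w₁ ∈ R × Chain R n w₁ u)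

GInf : ℕ → ℕ → Sequent → Sequent → Set
GInf n k P C = ∃[ w ] ∃[ u ] ∃[ v ]
  ( Chain (Rs C) n w u × Chain (Rs C) k w v
  × Rs P ↭ rel u v ∷ Rs C × Γ P ↭ Γ C × Δ P ↭ Δ C )

PDiaInf : Conds → Sequent → Sequent → Set
PDiaInf 𝒞 P C = ∃[ w ] ∃[ φ ] ∃[ u ]
  ( (w , ◇' φ) ∈ Δ C
  × Reach (SG (Gs 𝒞)) fwd (Rs C) w u
  × Rs P ↭ Rs C × Γ P ↭ Γ C × Δ P ↭ (u , φ) ∷ Δ C )

S1Inf : Conds → Sequent → Sequent → Set
S1Inf 𝒞 P C = ∃[ w ] ∃[ x ] ∃[ φ ] ∃[ y ]
  ( (w , ∃' x φ) ∈ Δ C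
  × Cond1 (hasI 𝒞) (hasD 𝒞) (Gs 𝒞) (Rs C) y w
  × Rs P ↭ Rs C × Γ P ↭ Γ C × Δ P ↭ (w , sub φ y x) ∷ Δ C )

S2Inf : Conds → Sequent → Sequent → Set
S2Inf 𝒞 P C = ∃[ w ] ∃[ x ] ∃[ φ ] ∃[ y ] ∃[ u ]
  ( (w , ∃' x φ) ∈ Δ C
  × Fresh y C
  × Cond2 (hasI 𝒞) (hasD 𝒞) (Gs 𝒞) (Rs C) w u
  × Rs P ↭ dom y u ∷ Rs C × Γ P ↭ Γ C × Δ P ↭ (w , sub φ y x) ∷ Δ C )

data RuleName : Set where
  pDia s∃¹ s∃² : RuleName

RInf : Conds → RuleName → Sequent → Sequent → Set
RInf 𝒞 pDia = PDiaInf 𝒞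
RInf 𝒞 s∃¹  = S1Inf 𝒞
RInf 𝒞 s∃²  = S2Inf 𝒞

module Submission where

open import Defs
open import Data.Bool using (true; false)
open import Data.Nat using (ℕ; zero; suc)
open import Data.Product using (Σ; _×_; _,_; ∃-syntax)
open import Data.List using (List; []; _∷_; _++_; replicate)
open import Data.List.Properties using (++-assoc)
open import Data.List.Membership.Propositional using (_∈_)
open import Data.List.Membership.Propositional.Properties using (∈-++⁺ʳ)
open import Data.List.Relation.Unary.Any using (here; there)
open import Data.List.Relation.Binary.Subset.Propositional using (_⊆_)
open import Data.List.Relation.Binary.Permutation.Propositional
  using (_↭_; ↭-refl; ↭-sym; ↭-trans)
open import Data.List.Relation.Binary.Permutation.Propositional.Properties
  using (∈-resp-↭; ++⁺ˡ; shift)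
open import Relation.Binary.PropositionalEquality using (_≡_; refl; subst; cong)
open import Relation.Binary.Construct.Closure.ReflexiveTransitive
  using (Star; ε; _◅_; _◅◅_; gmap)

-- A (g_{n,k}) step only adds the edge u R v, and that edge is already witnessed
-- by the chains w R^n u and w R^k v.  So any propagation path through u R v can
-- be rerouted: a forward use becomes (◇⁻¹)^n ◇^k and a backward use becomes
-- (◇⁻¹)^k ◇^n, which are exactly the productions of S(𝒢) for G(n,k).  Hence
-- every reachability condition that holds after the (g_{n,k}) step already holds
-- before it, while domain atoms and formulae are untouched; (r) can therefore be
-- applied below (g_{n,k}).  For S5 only the existence of a path matters, since
-- L_S5 is total.

Step-∷ : ∀ {S s t} c → Step S s t → Step S (c ∷ s) (c ∷ t)
Step-∷ c (step s' s'' a r a⟶r) = step (c ∷ s') s'' a r a⟶r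

Step*-++ˡ : ∀ {S s t} p → Star (Step S) s t → Star (Step S) (p ++ s) (p ++ t)
Step*-++ˡ []      st = st
Step*-++ˡ (c ∷ p) st = gmap (c ∷_) (Step-∷ c) (Step*-++ˡ p st)

Step*-rewrite-head : ∀ {S a r s t} → (a , r) ∈ S → Star (Step S) s t →
                     Star (Step S) (a ∷ s) (r ++ t)
Step*-rewrite-head {a = a} {r} {s} a⟶r st = step [] s a r a⟶r ◅ Step*-++ˡ r st

S5-erase : ∀ a → (a , []) ∈ S5
S5-erase fwd = here refl
S5-erase bwd = there (here refl)

S5-expand : ∀ a → (a , bwd ∷ fwd ∷ []) ∈ S5
S5-expand fwd = there (there (here refl))
S5-expand bwd = there (there (there (here refl)))

-- a ⟶ ◇⁻¹◇ ⟶ ◇⁻¹◇◇ ⟶ ◇◇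
L-S5-head : ∀ a c → L S5 a (c ∷ fwd ∷ [])
L-S5-head a bwd = step [] [] a _ (S5-expand a) ◅ ε
L-S5-head a fwd = step [] [] a _ (S5-expand a)
                ◅ step [] (fwd ∷ []) bwd _ (S5-expand bwd)
                ◅ step [] (fwd ∷ fwd ∷ []) bwd [] (S5-erase bwd)
                ◅ ε

L-S5-total : ∀ a s → L S5 a s
L-S5-total a []      = step [] [] a [] (S5-erase a) ◅ ε
L-S5-total a (c ∷ s) = L-S5-head a c ◅◅ gmap (c ∷_) (Step-∷ c) (L-S5-total fwd s)

SG-fwd : ∀ {n k G} → (n , k) ∈ G → (fwd , replicate n bwd ++ replicate k fwd) ∈ SG G
SG-fwd (here refl) = here refl
SG-fwd {G = _ ∷ _} (there nk∈G) = there (there (SG-fwd nk∈G))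

SG-bwd : ∀ {n k G} → (n , k) ∈ G → (bwd , replicate k bwd ++ replicate n fwd) ∈ SG G
SG-bwd (here refl) = there (here refl)
SG-bwd {G = _ ∷ _} (there nk∈G) = there (there (SG-bwd nk∈G))

Chain-mono : ∀ {R R'} n {w u} → R ⊆ R' → Chain R n w u → Chain R' n w u
Chain-mono zero    R⊆R' w≡u              = w≡u
Chain-mono (suc n) R⊆R' (w₁ , wRw₁ , ch) = w₁ , R⊆R' wRw₁ , Chain-mono n R⊆R' ch

replicate-snoc : ∀ {A : Set} n (x : A) s → replicate n x ++ x ∷ s ≡ x ∷ replicate n x ++ s
replicate-snoc zero    x s = refl
replicate-snoc (suc n) x s = cong (x ∷_) (replicate-snoc n x s)

Path-forwards : ∀ {R} n {w u z s} → Chain R n w u → Path R u z s →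
                Path R w z (replicate n fwd ++ s)
Path-forwards zero    refl            p = p
Path-forwards (suc n) (_ , wRw₁ , ch) p = fwdE wRw₁ (Path-forwards n ch p)

Path-backwards : ∀ {R} n {w u z s} → Chain R n w u → Path R w z s →
                 Path R u z (replicate n bwd ++ s)
Path-backwards zero refl p = p
Path-backwards {R} (suc n) {u = u} {z} {s} (_ , wRw₁ , ch) p =
  subst (Path R u z) (replicate-snoc n bwd s) (Path-backwards n ch (bwdE wRw₁ p))

Reach-S5 : ∀ {R a b s} d → Path R a b s → Reach S5 d R a b
Reach-S5 {s = s} d p = s , p , L-S5-total d s

module RemoveEdge {S : System} {R R' : List RAtom} {n k w u v : ℕ}
  (w⟶u : Chain R n w u) (w⟶v : Chain R k w v)
  (fwd∈S : (fwd , replicate n bwd ++ replicate k fwd) ∈ S)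
  (bwd∈S : (bwd , replicate k bwd ++ replicate n fwd) ∈ S)
  (R'⊆ : R' ⊆ rel u v ∷ R) where

  reroute : ∀ {a b s} → Path R' a b s → ∃[ s' ] (Path R a b s' × Star (Step S) s s')
  reroute nil = [] , nil , ε
  reroute (fwdE e p) with reroute p | R'⊆ e
  ... | s' , p' , st | there e' = fwd ∷ s' , fwdE e' p' , gmap _ (Step-∷ fwd) st
  ... | s' , p' , st | here refl =
    _ , Path-backwards n w⟶u (Path-forwards k w⟶v p') ,
    subst (Star (Step S) _) (++-assoc (replicate n bwd) _ s') (Step*-rewrite-head fwd∈S st)
  reroute (bwdE e p) with reroute p | R'⊆ e
  ... | s' , p' , st | there e' = bwd ∷ s' , bwdE e' p' , gmap _ (Step-∷ bwd) st
  ... | s' , p' , st | here refl =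
    _ , Path-backwards k w⟶v (Path-forwards n w⟶u p') ,
    subst (Star (Step S) _) (++-assoc (replicate k bwd) _ s') (Step*-rewrite-head bwd∈S st)

  Reach-reroute : ∀ {d a b} → Reach S d R' a b → Reach S d R a b
  Reach-reroute (s , p , s∈L) with reroute p
  ... | s' , p' , st = s' , p' , (s∈L ◅◅ st)

  dom-reroute : ∀ {y z} → dom y z ∈ R' → dom y z ∈ R
  dom-reroute y∈z with R'⊆ y∈z
  ... | there y∈z' = y∈z'

module RemoveGEdge {G : List (ℕ × ℕ)} {n k : ℕ} (nk∈G : (n , k) ∈ G)
  {R R' : List RAtom} {w u v : ℕ}
  (w⟶u : Chain R n w u) (w⟶v : Chain R k w v) (R'⊆ : R' ⊆ rel u v ∷ R) where

  open RemoveEdge {S = S4 ++ SG G} w⟶u w⟶v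
    (∈-++⁺ʳ S4 (SG-fwd nk∈G)) (∈-++⁺ʳ S4 (SG-bwd nk∈G)) R'⊆
    public using (Reach-reroute; dom-reroute)
  -- (p◇) only uses S(𝒢), without S4.
  open RemoveEdge {S = SG G} w⟶u w⟶v (SG-fwd nk∈G) (SG-bwd nk∈G) R'⊆
    public using (reroute) renaming (Reach-reroute to Reach-SG-reroute)

  Reach-S5-reroute : ∀ {d a b} → Reach S5 d R' a b → Reach S5 d R a b
  Reach-S5-reroute {d} (_ , p , _) with reroute p
  ... | _ , p' , _ = Reach-S5 d p'

  Cond1-reroute : ∀ i d {y z} → Cond1 i d G R' y z → Cond1 i d G R y z
  Cond1-reroute true  true  (x , y∈x , r) = x , dom-reroute y∈x , Reach-S5-reroute r
  Cond1-reroute true  false (x , y∈x , r) = x , dom-reroute y∈x , Reach-reroute r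
  Cond1-reroute false true  (x , y∈x , r) = x , dom-reroute y∈x , Reach-reroute r
  Cond1-reroute false false y∈z           = dom-reroute y∈z

  Cond2-reroute : ∀ i d {a z} → Cond2 i d G R' a z → Cond2 i d G R a z
  Cond2-reroute true  true  r   = Reach-S5-reroute r
  Cond2-reroute true  false r   = Reach-reroute r
  Cond2-reroute false true  r   = Reach-reroute r
  Cond2-reroute false false a≡z = a≡z

GInf-extend : ∀ {n k P Q C} rs lfs → GInf n k Q C →
              Rs P ↭ rs ++ Rs Q → Γ P ↭ Γ Q → Δ P ↭ lfs ++ Δ Q →
              GInf n k P ((rs ++ Rs C) ∣ Γ C ⊢ (lfs ++ Δ C))
GInf-extend {n} {k} {C = C} rs lfs (w , u , v , w⟶u , w⟶v , RQ↭ , ΓQ↭ , ΔQ↭) RP↭ ΓP↭ ΔP↭ =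
  w , u , v , Chain-mono n (∈-++⁺ʳ rs) w⟶u , Chain-mono k (∈-++⁺ʳ rs) w⟶v ,
  ↭-trans RP↭ (↭-trans (++⁺ˡ rs RQ↭) (shift (rel u v) rs (Rs C))) ,
  ↭-trans ΓP↭ ΓQ↭ , ↭-trans ΔP↭ (++⁺ˡ lfs ΔQ↭)

↭⇒⊆ : ∀ {A : Set} {xs ys : List A} → xs ↭ ys → xs ⊆ ys
↭⇒⊆ xs↭ys = ∈-resp-↭ xs↭ys

Fresh-GInf : ∀ {n k Q C y} → GInf n k Q C → Fresh y Q → Fresh y C
Fresh-GInf (_ , _ , _ , _ , _ , RQ↭ , ΓQ↭ , ΔQ↭) (yR , yΓ , yΔ) =
  (λ z y∈z → yR z (↭⇒⊆ (↭-sym RQ↭) (there y∈z))) ,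
  (λ lf lf∈ → yΓ lf (↭⇒⊆ (↭-sym ΓQ↭) lf∈)) ,
  (λ lf lf∈ → yΔ lf (↭⇒⊆ (↭-sym ΔQ↭) lf∈))

Permutes : Conds → ℕ → ℕ → (Sequent → Sequent → Set) → Set
Permutes 𝒞 n k Rule = ∀ {P Q C} → Rule P Q → GInf n k Q C →
                      Σ Sequent (λ M → GInf n k P M × Rule M C)

permute-pDia : ∀ 𝒞 {n k} → (n , k) ∈ Gs 𝒞 → Permutes 𝒞 n k (PDiaInf 𝒞)
permute-pDia 𝒞 nk∈G (w' , φ , u' , ◇φ∈ , reach , RP↭ , ΓP↭ , ΔP↭)
             g@(_ , _ , _ , w⟶u , w⟶v , RQ↭ , _ , ΔQ↭) =
  _ , GInf-extend [] ((u' , φ) ∷ []) g RP↭ ΓP↭ ΔP↭ ,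
  w' , φ , u' , ↭⇒⊆ ΔQ↭ ◇φ∈ , Reach-SG-reroute reach , ↭-refl , ↭-refl , ↭-refl
  where open RemoveGEdge nk∈G w⟶u w⟶v (↭⇒⊆ RQ↭)

permute-s∃¹ : ∀ 𝒞 {n k} → (n , k) ∈ Gs 𝒞 → Permutes 𝒞 n k (S1Inf 𝒞)
permute-s∃¹ 𝒞 nk∈G (w' , x , φ , y , ∃φ∈ , cond , RP↭ , ΓP↭ , ΔP↭)
            g@(_ , _ , _ , w⟶u , w⟶v , RQ↭ , _ , ΔQ↭) =
  _ , GInf-extend [] ((w' , sub φ y x) ∷ []) g RP↭ ΓP↭ ΔP↭ ,
  w' , x , φ , y , ↭⇒⊆ ΔQ↭ ∃φ∈ , Cond1-reroute (hasI 𝒞) (hasD 𝒞) cond ,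
  ↭-refl , ↭-refl , ↭-refl
  where open RemoveGEdge nk∈G w⟶u w⟶v (↭⇒⊆ RQ↭)

permute-s∃² : ∀ 𝒞 {n k} → (n , k) ∈ Gs 𝒞 → Permutes 𝒞 n k (S2Inf 𝒞)
permute-s∃² 𝒞 nk∈G (w' , x , φ , y , u' , ∃φ∈ , fresh , cond , RP↭ , ΓP↭ , ΔP↭)
            g@(_ , _ , _ , w⟶u , w⟶v , RQ↭ , _ , ΔQ↭) =
  _ , GInf-extend (dom y u' ∷ []) ((w' , sub φ y x) ∷ []) g RP↭ ΓP↭ ΔP↭ ,
  w' , x , φ , y , u' , ↭⇒⊆ ΔQ↭ ∃φ∈ , Fresh-GInf g fresh ,
  Cond2-reroute (hasI 𝒞) (hasD 𝒞) cond , ↭-refl , ↭-refl , ↭-refl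
  where open RemoveGEdge nk∈G w⟶u w⟶v (↭⇒⊆ RQ↭)

mainTheorem2 : (𝒞 : Conds) (n k : ℕ) → (n , k) ∈ Gs 𝒞 → (r : RuleName)
    → (P Q C : Sequent) → RInf 𝒞 r P Q → GInf n k Q C
    → Σ Sequent (λ M → GInf n k P M × RInf 𝒞 r M C)
mainTheorem2 𝒞 n k nk∈G pDia P Q C = permute-pDia 𝒞 nk∈G
mainTheorem2 𝒞 n k nk∈G s∃¹  P Q C = permute-s∃¹ 𝒞 nk∈G
mainTheorem2 𝒞 n k nk∈G s∃²  P Q C = permute-s∃² 𝒞 nk∈G
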